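{- For every $d\in\mathbb{N}$ we have $F_d(x,1)=A_d(x)$, where $F_d(x,1)$ is understood as $\lim_{y\to1}F_d(x,y)$.
   Context: The polynomials $F_d(x,y)$ are defined recursively by $F_1(x,y)=1$ and, for $d\ge2$, $$F_d(x,y)=\frac{(1-xy^d)F_{d-1}(x,y)-y(1-x)F_{d-1}(xy,y)}{1-y}.$$ The Eulerian polynomials $A_d(x)$ are defined by $\sum_{j\ge0}(j+1)^dx^j=\frac{A_d(x)}{(1-x)^{d+1}}$; equivalently $A_0=1$ and $A_d(x)=(1+(d-1)x)A_{d-1}(x)+x(1-x)A_{d-1}'(x)$ for $d\ge1$. -}

module Defs where

open import Data.Nat using (ℕ; zero; suc)
open import Data.Integer using (ℤ; +_; _+_; _*_; -_; 0ℤ; 1ℤ)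
open import Data.List using (List; []; _∷_; map; foldr; replicate; _++_)

-- Univariate polynomials in x over ℤ: ascending coefficient lists
-- (the list a₀ ∷ a₁ ∷ … represents a₀ + a₁ x + …; trailing zeros allowed).

Poly1 : Set
Poly1 = List ℤ

add1 : Poly1 → Poly1 → Poly1
add1 []      q       = q
add1 (a ∷ p) []      = a ∷ p
add1 (a ∷ p) (b ∷ q) = (a + b) ∷ add1 p q

scale1 : ℤ → Poly1 → Poly1
scale1 c = map (c *_)

neg1 : Poly1 → Poly1
neg1 = scale1 (- 1ℤ)

xmul1 : Poly1 → Poly1
xmul1 p = 0ℤ ∷ p

derivAux : ℕ → Poly1 → Poly1
derivAux k []       = []
derivAux k (c ∷ cs) = ((+ k) * c) ∷ derivAux (suc k) cs

deriv : Poly1 → Poly1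
deriv []       = []
deriv (c ∷ cs) = derivAux 1 cs

coeff : ℕ → Poly1 → ℤ
coeff n       []      = 0ℤ
coeff zero    (a ∷ p) = a
coeff (suc n) (a ∷ p) = coeff n p

-- Bivariate polynomials in x, y over ℤ: ascending lists in y whose
-- entries are polynomials in x (P₀ ∷ P₁ ∷ … represents Σ_j P_j(x) y^j).

Poly2 : Set
Poly2 = List Poly1

one2 : Poly2
one2 = (1ℤ ∷ []) ∷ []

add2 : Poly2 → Poly2 → Poly2
add2 []      Q       = Q
add2 (p ∷ P) []      = p ∷ P
add2 (p ∷ P) (q ∷ Q) = add1 p q ∷ add2 P Q

neg2 : Poly2 → Poly2
neg2 = map neg1

xmul2 : Poly2 → Poly2
xmul2 = map xmul1

ymul2 : Poly2 → Poly2
ymul2 P = [] ∷ P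

ypow2 : ℕ → Poly2 → Poly2
ypow2 k P = replicate k [] ++ P

-- q(x) ↦ q(xy), as a bivariate polynomial:  Σ_i q_i x^i y^i
spread : Poly1 → Poly2
spread []       = []
spread (c ∷ cs) = (c ∷ []) ∷ map xmul1 (spread cs)

-- substitution P(x,y) ↦ P(xy,y)
substXY : Poly2 → Poly2
substXY []      = []
substXY (q ∷ P) = add2 (spread q) (ymul2 (substXY P))

-- When (1 - y) divides H (which is always the case for the numerators
-- below, since they vanish at y = 1) this is the exact quotient H/(1-y)
-- (the top entry is H(x,1) = 0).
divAux : Poly1 → Poly2 → Poly2
divAux acc []      = []
divAux acc (h ∷ H) = add1 acc h ∷ divAux (add1 acc h) H

divOneMinusY : Poly2 → Poly2
divOneMinusY = divAux []

evalY1 : Poly2 → Poly1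
evalY1 = foldr add1 []

-- F_d :  F_1 = 1,
--   F_d = ((1 - x y^d) F_{d-1}(x,y) - y (1 - x) F_{d-1}(xy,y)) / (1 - y).
-- F 0 is an unused junk value (F_d is only defined for d ≥ 1).

Fstep : ℕ → Poly2 → Poly2
Fstep d G =
  divOneMinusY
    (add2 (add2 G (neg2 (xmul2 (ypow2 d G))))
          (neg2 (ymul2 (add2 S (neg2 (xmul2 S))))))
  where
  S : Poly2
  S = substXY G

F : ℕ → Poly2
F zero          = []
F (suc zero)    = one2
F (suc (suc k)) = Fstep (suc (suc k)) (F (suc k))

A : ℕ → Poly1
A zero    = 1ℤ ∷ []
A (suc d) =
  add1 (add1 Ad (scale1 (+ d) (xmul1 Ad)))
       (add1 (xmul1 Ad') (neg1 (xmul1 (xmul1 Ad'))))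
  where
  Ad  = A d
  Ad' = deriv Ad

{-# OPTIONS --safe #-}

-- The numerator N of the recursion vanishes at y = 1, so dividing by 1 - y and then
-- setting y = 1 amounts to taking -∂N/∂y at y = 1 (L'Hôpital).  With g = F_{d-1}(x,1)
-- and δ = ∂F_{d-1}/∂y (x,1), the chain rule gives ∂/∂y [F_{d-1}(xy,y)] at y = 1 equal to
-- x g' + δ; in -∂N/∂y (x,1) all δ-terms cancel and what remains is
-- (1 + (d-1)x) g + x(1-x) g', the Eulerian recurrence.

module Submission where

open import Defs
open import Data.Nat using (ℕ; _≤_; zero; suc) renaming (_+_ to _+ℕ_)
import Data.Nat.Properties as ℕ
open import Data.Integer using (ℤ; +_; _+_; _*_; -_; _-_; 0ℤ; 1ℤ)
open import Data.Integer.Properties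
  using (+-identityˡ; +-identityʳ; +-assoc; +-inverseʳ; *-zeroˡ; *-zeroʳ; *-distribˡ-+;
         neg-distrib-+; -1*i≡-i; suc-*; +-commutativeSemigroup)
open import Data.Integer.Tactic.RingSolver using (solve-∀)
open import Data.List using ([]; _∷_; length)
open import Function using (_∘_)
open import Algebra.Properties.CommutativeSemigroup +-commutativeSemigroup using (interchange)
open import Relation.Binary.PropositionalEquality
  using (_≡_; refl; sym; trans; cong; cong₂; module ≡-Reasoning)
open ≡-Reasoning

-- Coefficientwise equality: lists differing by trailing zeros denote the same polynomial.
infix 4 _≋_

_≋_ : Poly1 → Poly1 → Set
p ≋ q = ∀ n → coeff n p ≡ coeff n q

coeff-add1 : ∀ n p q → coeff n (add1 p q) ≡ coeff n p + coeff n q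
coeff-add1 n       []      q       = sym (+-identityˡ _)
coeff-add1 n       (a ∷ p) []      = sym (+-identityʳ _)
coeff-add1 zero    (a ∷ p) (b ∷ q) = refl
coeff-add1 (suc n) (a ∷ p) (b ∷ q) = coeff-add1 n p q

coeff-scale1 : ∀ n c p → coeff n (scale1 c p) ≡ c * coeff n p
coeff-scale1 n       c []      = sym (*-zeroʳ c)
coeff-scale1 zero    c (a ∷ p) = refl
coeff-scale1 (suc n) c (a ∷ p) = coeff-scale1 n c p

coeff-neg1 : ∀ n p → coeff n (neg1 p) ≡ - coeff n p
coeff-neg1 n p = trans (coeff-scale1 n (- 1ℤ) p) (-1*i≡-i (coeff n p))

xmul1-cong : ∀ {p q} → p ≋ q → xmul1 p ≋ xmul1 q
xmul1-cong p≋q zero    = refl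
xmul1-cong p≋q (suc n) = p≋q n

coeff-xmul1-add1 : ∀ n p q → coeff n (xmul1 (add1 p q)) ≡ coeff n (xmul1 p) + coeff n (xmul1 q)
coeff-xmul1-add1 zero    p q = refl
coeff-xmul1-add1 (suc n) p q = coeff-add1 n p q

coeff-xmul1-scale1 : ∀ n c p → coeff n (xmul1 (scale1 c p)) ≡ c * coeff n (xmul1 p)
coeff-xmul1-scale1 zero    c p = sym (*-zeroʳ c)
coeff-xmul1-scale1 (suc n) c p = coeff-scale1 n c p

coeff-derivAux : ∀ n k cs → coeff n (derivAux k cs) ≡ + (k +ℕ n) * coeff n cs
coeff-derivAux n       k []       = sym (*-zeroʳ (+ (k +ℕ n)))
coeff-derivAux zero    k (c ∷ cs) = cong (λ m → + m * c) (sym (ℕ.+-identityʳ k))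
coeff-derivAux (suc n) k (c ∷ cs) =
  trans (coeff-derivAux n (suc k) cs) (cong (λ m → + m * coeff n cs) (sym (ℕ.+-suc k n)))

coeff-xmul1-deriv : ∀ n p → coeff n (xmul1 (deriv p)) ≡ + n * coeff n p
coeff-xmul1-deriv zero    p        = sym (*-zeroˡ (coeff zero p))
coeff-xmul1-deriv (suc n) []       = sym (*-zeroʳ (+ suc n))
coeff-xmul1-deriv (suc n) (c ∷ cs) = coeff-derivAux n 1 cs

xmul1-deriv-cong : ∀ {p q} → p ≋ q → xmul1 (deriv p) ≋ xmul1 (deriv q)
xmul1-deriv-cong {p} {q} p≋q n = begin
  coeff n (xmul1 (deriv p)) ≡⟨ coeff-xmul1-deriv n p ⟩
  + n * coeff n p           ≡⟨ cong (+ n *_) (p≋q n) ⟩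
  + n * coeff n q           ≡⟨ coeff-xmul1-deriv n q ⟨
  coeff n (xmul1 (deriv q)) ∎

evalY1-add2 : ∀ n P Q → coeff n (evalY1 (add2 P Q)) ≡ coeff n (evalY1 P) + coeff n (evalY1 Q)
evalY1-add2 n []      Q       = sym (+-identityˡ _)
evalY1-add2 n (p ∷ P) []      = sym (+-identityʳ _)
evalY1-add2 n (p ∷ P) (q ∷ Q) = begin
  coeff n (add1 (add1 p q) (evalY1 (add2 P Q)))
    ≡⟨ coeff-add1 n (add1 p q) _ ⟩
  coeff n (add1 p q) + coeff n (evalY1 (add2 P Q))
    ≡⟨ cong₂ _+_ (coeff-add1 n p q) (evalY1-add2 n P Q) ⟩
  (coeff n p + coeff n q) + (coeff n (evalY1 P) + coeff n (evalY1 Q))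
    ≡⟨ interchange (coeff n p) (coeff n q) _ _ ⟩
  (coeff n p + coeff n (evalY1 P)) + (coeff n q + coeff n (evalY1 Q))
    ≡⟨ cong₂ _+_ (coeff-add1 n p (evalY1 P)) (coeff-add1 n q (evalY1 Q)) ⟨
  coeff n (evalY1 (p ∷ P)) + coeff n (evalY1 (q ∷ Q)) ∎

evalY1-neg2 : ∀ n P → coeff n (evalY1 (neg2 P)) ≡ - coeff n (evalY1 P)
evalY1-neg2 n []      = refl
evalY1-neg2 n (p ∷ P) = begin
  coeff n (add1 (neg1 p) (evalY1 (neg2 P)))           ≡⟨ coeff-add1 n (neg1 p) _ ⟩
  coeff n (neg1 p) + coeff n (evalY1 (neg2 P))        ≡⟨ cong₂ _+_ (coeff-neg1 n p) (evalY1-neg2 n P) ⟩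
  - coeff n p + - coeff n (evalY1 P)                   ≡⟨ neg-distrib-+ (coeff n p) _ ⟨
  - (coeff n p + coeff n (evalY1 P))                   ≡⟨ cong -_ (coeff-add1 n p (evalY1 P)) ⟨
  - coeff n (evalY1 (p ∷ P))                           ∎

sub2 : Poly2 → Poly2 → Poly2
sub2 P Q = add2 P (neg2 Q)

evalY1-sub2 : ∀ n P Q → coeff n (evalY1 (sub2 P Q)) ≡ coeff n (evalY1 P) - coeff n (evalY1 Q)
evalY1-sub2 n P Q =
  trans (evalY1-add2 n P (neg2 Q)) (cong (_+_ (coeff n (evalY1 P))) (evalY1-neg2 n Q))

evalY1-xmul2 : ∀ P → evalY1 (xmul2 P) ≋ xmul1 (evalY1 P)
evalY1-xmul2 []      zero    = refl
evalY1-xmul2 []      (suc n) = refl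
evalY1-xmul2 (p ∷ P) n = begin
  coeff n (add1 (xmul1 p) (evalY1 (xmul2 P)))             ≡⟨ coeff-add1 n (xmul1 p) (evalY1 (xmul2 P)) ⟩
  coeff n (xmul1 p) + coeff n (evalY1 (xmul2 P))          ≡⟨ cong (_+_ (coeff n (xmul1 p))) (evalY1-xmul2 P n) ⟩
  coeff n (xmul1 p) + coeff n (xmul1 (evalY1 P))          ≡⟨ coeff-xmul1-add1 n p (evalY1 P) ⟨
  coeff n (xmul1 (evalY1 (p ∷ P)))                        ∎

evalY1-ypow2 : ∀ k P → evalY1 (ypow2 k P) ≡ evalY1 P
evalY1-ypow2 zero    P = refl
evalY1-ypow2 (suc k) P = evalY1-ypow2 k P

evalY1-spread : ∀ q → evalY1 (spread q) ≋ q
evalY1-spread []       n = refl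
evalY1-spread (c ∷ cs) n =
  trans (coeff-add1 n (c ∷ []) (evalY1 (xmul2 (spread cs))))
        (shift n (trans (evalY1-xmul2 (spread cs) n) (xmul1-cong (evalY1-spread cs) n)))
  where
  shift : ∀ n → coeff n (evalY1 (xmul2 (spread cs))) ≡ coeff n (xmul1 cs)
        → coeff n (c ∷ []) + coeff n (evalY1 (xmul2 (spread cs))) ≡ coeff n (c ∷ cs)
  shift zero    eq = trans (cong (_+_ c) eq) (+-identityʳ c)
  shift (suc n) eq = trans (+-identityˡ _) eq

evalY1-substXY : ∀ P → evalY1 (substXY P) ≋ evalY1 P
evalY1-substXY []      n = refl
evalY1-substXY (q ∷ P) n = begin
  coeff n (evalY1 (add2 (spread q) ([] ∷ substXY P)))
    ≡⟨ evalY1-add2 n (spread q) _ ⟩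
  coeff n (evalY1 (spread q)) + coeff n (evalY1 (substXY P))
    ≡⟨ cong₂ _+_ (evalY1-spread q n) (evalY1-substXY P n) ⟩
  coeff n q + coeff n (evalY1 P)
    ≡⟨ coeff-add1 n q (evalY1 P) ⟨
  coeff n (evalY1 (q ∷ P)) ∎

-- For P = Σ_j P_j y^j this is Σ_j j P_j = ∂P/∂y at y = 1.
derivY1 : Poly2 → Poly1
derivY1 []      = []
derivY1 (p ∷ P) = add1 (evalY1 P) (derivY1 P)

derivY1-add2 : ∀ n P Q → coeff n (derivY1 (add2 P Q)) ≡ coeff n (derivY1 P) + coeff n (derivY1 Q)
derivY1-add2 n []      Q       = sym (+-identityˡ _)
derivY1-add2 n (p ∷ P) []      = sym (+-identityʳ _)
derivY1-add2 n (p ∷ P) (q ∷ Q) = begin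
  coeff n (add1 (evalY1 (add2 P Q)) (derivY1 (add2 P Q)))
    ≡⟨ coeff-add1 n (evalY1 (add2 P Q)) (derivY1 (add2 P Q)) ⟩
  coeff n (evalY1 (add2 P Q)) + coeff n (derivY1 (add2 P Q))
    ≡⟨ cong₂ _+_ (evalY1-add2 n P Q) (derivY1-add2 n P Q) ⟩
  (coeff n (evalY1 P) + coeff n (evalY1 Q)) + (coeff n (derivY1 P) + coeff n (derivY1 Q))
    ≡⟨ interchange (coeff n (evalY1 P)) (coeff n (evalY1 Q)) _ _ ⟩
  (coeff n (evalY1 P) + coeff n (derivY1 P)) + (coeff n (evalY1 Q) + coeff n (derivY1 Q))
    ≡⟨ cong₂ _+_ (coeff-add1 n (evalY1 P) (derivY1 P)) (coeff-add1 n (evalY1 Q) (derivY1 Q)) ⟨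
  coeff n (derivY1 (p ∷ P)) + coeff n (derivY1 (q ∷ Q)) ∎

derivY1-neg2 : ∀ n P → coeff n (derivY1 (neg2 P)) ≡ - coeff n (derivY1 P)
derivY1-neg2 n []      = refl
derivY1-neg2 n (p ∷ P) = begin
  coeff n (add1 (evalY1 (neg2 P)) (derivY1 (neg2 P)))
    ≡⟨ coeff-add1 n (evalY1 (neg2 P)) (derivY1 (neg2 P)) ⟩
  coeff n (evalY1 (neg2 P)) + coeff n (derivY1 (neg2 P))
    ≡⟨ cong₂ _+_ (evalY1-neg2 n P) (derivY1-neg2 n P) ⟩
  - coeff n (evalY1 P) + - coeff n (derivY1 P)
    ≡⟨ neg-distrib-+ (coeff n (evalY1 P)) (coeff n (derivY1 P)) ⟨
  - (coeff n (evalY1 P) + coeff n (derivY1 P))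
    ≡⟨ cong -_ (coeff-add1 n (evalY1 P) (derivY1 P)) ⟨
  - coeff n (derivY1 (p ∷ P)) ∎

derivY1-sub2 : ∀ n P Q → coeff n (derivY1 (sub2 P Q)) ≡ coeff n (derivY1 P) - coeff n (derivY1 Q)
derivY1-sub2 n P Q =
  trans (derivY1-add2 n P (neg2 Q)) (cong (_+_ (coeff n (derivY1 P))) (derivY1-neg2 n Q))

derivY1-xmul2 : ∀ P → derivY1 (xmul2 P) ≋ xmul1 (derivY1 P)
derivY1-xmul2 []      zero    = refl
derivY1-xmul2 []      (suc n) = refl
derivY1-xmul2 (p ∷ P) n = begin
  coeff n (add1 (evalY1 (xmul2 P)) (derivY1 (xmul2 P)))
    ≡⟨ coeff-add1 n (evalY1 (xmul2 P)) (derivY1 (xmul2 P)) ⟩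
  coeff n (evalY1 (xmul2 P)) + coeff n (derivY1 (xmul2 P))
    ≡⟨ cong₂ _+_ (evalY1-xmul2 P n) (derivY1-xmul2 P n) ⟩
  coeff n (xmul1 (evalY1 P)) + coeff n (xmul1 (derivY1 P))
    ≡⟨ coeff-xmul1-add1 n (evalY1 P) (derivY1 P) ⟨
  coeff n (xmul1 (derivY1 (p ∷ P))) ∎

derivY1-ypow2 : ∀ k P → derivY1 (ypow2 k P) ≋ add1 (scale1 (+ k) (evalY1 P)) (derivY1 P)
derivY1-ypow2 k P n = trans (weighted k) (sym (trans (coeff-add1 n (scale1 (+ k) (evalY1 P)) (derivY1 P))
                                                     (cong (_+ δ) (coeff-scale1 n (+ k) (evalY1 P)))))
  where
  e δ : ℤ
  e = coeff n (evalY1 P)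
  δ = coeff n (derivY1 P)
  weighted : ∀ k → coeff n (derivY1 (ypow2 k P)) ≡ + k * e + δ
  weighted zero    = sym (trans (cong (_+ δ) (*-zeroˡ e)) (+-identityˡ δ))
  weighted (suc k) = begin
    coeff n (add1 (evalY1 (ypow2 k P)) (derivY1 (ypow2 k P)))
      ≡⟨ coeff-add1 n (evalY1 (ypow2 k P)) (derivY1 (ypow2 k P)) ⟩
    coeff n (evalY1 (ypow2 k P)) + coeff n (derivY1 (ypow2 k P))
      ≡⟨ cong₂ _+_ (cong (coeff n) (evalY1-ypow2 k P)) (weighted k) ⟩
    e + (+ k * e + δ)
      ≡⟨ +-assoc e (+ k * e) δ ⟨
    (e + + k * e) + δ
      ≡⟨ cong (_+ δ) (suc-* (+ k) e) ⟨
    + suc k * e + δ ∎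

derivY1-spread : ∀ q → derivY1 (spread q) ≋ xmul1 (deriv q)
derivY1-spread q n = trans (weighted q n) (sym (coeff-xmul1-deriv n q))
  where
  weighted : ∀ q n → coeff n (derivY1 (spread q)) ≡ + n * coeff n q
  weighted []       n = sym (*-zeroʳ (+ n))
  weighted (c ∷ cs) n = begin
    coeff n (add1 (evalY1 (xmul2 (spread cs))) (derivY1 (xmul2 (spread cs))))
      ≡⟨ coeff-add1 n (evalY1 (xmul2 (spread cs))) (derivY1 (xmul2 (spread cs))) ⟩
    coeff n (evalY1 (xmul2 (spread cs))) + coeff n (derivY1 (xmul2 (spread cs)))
      ≡⟨ cong₂ _+_ (trans (evalY1-xmul2 (spread cs) n) (xmul1-cong (evalY1-spread cs) n))
                   (derivY1-xmul2 (spread cs) n) ⟩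
    coeff n (xmul1 cs) + coeff n (xmul1 (derivY1 (spread cs)))
      ≡⟨ shifted n ⟩
    + n * coeff n (c ∷ cs) ∎
    where
    shifted : ∀ n → coeff n (xmul1 cs) + coeff n (xmul1 (derivY1 (spread cs))) ≡ + n * coeff n (c ∷ cs)
    shifted zero    = sym (*-zeroˡ c)
    shifted (suc m) = begin
      coeff m cs + coeff m (derivY1 (spread cs)) ≡⟨ cong (_+_ (coeff m cs)) (weighted cs m) ⟩
      coeff m cs + + m * coeff m cs               ≡⟨ suc-* (+ m) (coeff m cs) ⟨
      + suc m * coeff m cs                        ∎

coeff-xmul1-deriv-add1 : ∀ n p q →
  coeff n (xmul1 (deriv (add1 p q))) ≡ coeff n (xmul1 (deriv p)) + coeff n (xmul1 (deriv q))
coeff-xmul1-deriv-add1 n p q = begin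
  coeff n (xmul1 (deriv (add1 p q)))                       ≡⟨ coeff-xmul1-deriv n (add1 p q) ⟩
  + n * coeff n (add1 p q)                                 ≡⟨ cong (+ n *_) (coeff-add1 n p q) ⟩
  + n * (coeff n p + coeff n q)                            ≡⟨ *-distribˡ-+ (+ n) (coeff n p) (coeff n q) ⟩
  + n * coeff n p + + n * coeff n q                        ≡⟨ cong₂ _+_ (coeff-xmul1-deriv n p) (coeff-xmul1-deriv n q) ⟨
  coeff n (xmul1 (deriv p)) + coeff n (xmul1 (deriv q))    ∎

derivY1-substXY : ∀ P → derivY1 (substXY P) ≋ add1 (xmul1 (deriv (evalY1 P))) (derivY1 P)
derivY1-substXY []      zero    = refl
derivY1-substXY []      (suc n) = refl
derivY1-substXY (q ∷ P) n = begin
  coeff n (derivY1 (add2 (spread q) ([] ∷ substXY P)))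
    ≡⟨ derivY1-add2 n (spread q) ([] ∷ substXY P) ⟩
  coeff n (derivY1 (spread q)) + coeff n (add1 (evalY1 (substXY P)) (derivY1 (substXY P)))
    ≡⟨ cong (_+_ (coeff n (derivY1 (spread q)))) (coeff-add1 n (evalY1 (substXY P)) (derivY1 (substXY P))) ⟩
  coeff n (derivY1 (spread q)) + (coeff n (evalY1 (substXY P)) + coeff n (derivY1 (substXY P)))
    ≡⟨ cong₂ (λ a b → a + (coeff n (evalY1 (substXY P)) + b))
             (derivY1-spread q n)
             (trans (derivY1-substXY P n) (coeff-add1 n (xmul1 (deriv e)) (derivY1 P))) ⟩
  coeff n (xmul1 (deriv q)) + (coeff n (evalY1 (substXY P)) + (coeff n (xmul1 (deriv e)) + coeff n δ))
    ≡⟨ cong (λ a → coeff n (xmul1 (deriv q)) + (a + (coeff n (xmul1 (deriv e)) + coeff n δ)))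
            (evalY1-substXY P n) ⟩
  coeff n (xmul1 (deriv q)) + (coeff n e + (coeff n (xmul1 (deriv e)) + coeff n δ))
    ≡⟨ regroup (coeff n (xmul1 (deriv q))) (coeff n e) (coeff n (xmul1 (deriv e))) (coeff n δ) ⟩
  (coeff n (xmul1 (deriv q)) + coeff n (xmul1 (deriv e))) + (coeff n e + coeff n δ)
    ≡⟨ cong₂ _+_ (coeff-xmul1-deriv-add1 n q e) (coeff-add1 n e δ) ⟨
  coeff n (xmul1 (deriv (add1 q e))) + coeff n (add1 e δ)
    ≡⟨ coeff-add1 n (xmul1 (deriv (add1 q e))) (add1 e δ) ⟨
  coeff n (add1 (xmul1 (deriv (evalY1 (q ∷ P)))) (derivY1 (q ∷ P))) ∎
  where
  e δ : Poly1
  e = evalY1 P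
  δ = derivY1 P
  regroup : ∀ a b c d → a + (b + (c + d)) ≡ (a + c) + (b + d)
  regroup = solve-∀

evalY1-divAux : ∀ n acc H →
  coeff n (evalY1 (divAux acc H)) ≡
  + length H * (coeff n acc + coeff n (evalY1 H)) - coeff n (derivY1 H)
evalY1-divAux n acc []      = sym (*-zeroˡ (coeff n acc + 0ℤ))
evalY1-divAux n acc (h ∷ H) = begin
  coeff n (add1 (add1 acc h) (evalY1 (divAux (add1 acc h) H)))
    ≡⟨ coeff-add1 n (add1 acc h) (evalY1 (divAux (add1 acc h) H)) ⟩
  coeff n (add1 acc h) + coeff n (evalY1 (divAux (add1 acc h) H))
    ≡⟨ cong (_+_ (coeff n (add1 acc h))) (evalY1-divAux n (add1 acc h) H) ⟩
  coeff n (add1 acc h) + (+ length H * (coeff n (add1 acc h) + e) - δ)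
    ≡⟨ cong (λ b → b + (+ length H * (b + e) - δ)) (coeff-add1 n acc h) ⟩
  (a + coeff n h) + (+ length H * ((a + coeff n h) + e) - δ)
    ≡⟨ regroup (+ length H) a (coeff n h) e δ ⟩
  (1ℤ + + length H) * (a + (coeff n h + e)) - (e + δ)
    ≡⟨ cong₂ (λ b c → (1ℤ + + length H) * (a + b) - c) (coeff-add1 n h (evalY1 H))
                                                          (coeff-add1 n (evalY1 H) (derivY1 H)) ⟨
  + length (h ∷ H) * (a + coeff n (evalY1 (h ∷ H))) - coeff n (derivY1 (h ∷ H)) ∎
  where
  a e δ : ℤ
  a = coeff n acc
  e = coeff n (evalY1 H)
  δ = coeff n (derivY1 H)
  regroup : ∀ L a h e δ → (a + h) + (L * ((a + h) + e) - δ) ≡ (1ℤ + L) * (a + (h + e)) - (e + δ)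
  regroup = solve-∀

-- L'Hôpital's rule at y = 1.
evalY1-divOneMinusY : ∀ H → evalY1 H ≋ [] → evalY1 (divOneMinusY H) ≋ neg1 (derivY1 H)
evalY1-divOneMinusY H H[1]≋0 n = begin
  coeff n (evalY1 (divAux [] H))
    ≡⟨ evalY1-divAux n [] H ⟩
  + length H * (0ℤ + coeff n (evalY1 H)) - δ
    ≡⟨ cong (λ e → + length H * e - δ) (trans (+-identityˡ (coeff n (evalY1 H))) (H[1]≋0 n)) ⟩
  + length H * 0ℤ - δ
    ≡⟨ cong (_- δ) (*-zeroʳ (+ length H)) ⟩
  0ℤ - δ
    ≡⟨ +-identityˡ (- δ) ⟩
  - δ
    ≡⟨ coeff-neg1 n (derivY1 H) ⟨
  coeff n (neg1 (derivY1 H)) ∎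
  where
  δ : ℤ
  δ = coeff n (derivY1 H)

-- A (suc d) unfolds definitionally to eulerianStep d (A d).
eulerianStep : ℕ → Poly1 → Poly1
eulerianStep d p =
  add1 (add1 p (scale1 (+ d) (xmul1 p)))
       (add1 (xmul1 (deriv p)) (neg1 (xmul1 (xmul1 (deriv p)))))

coeff-eulerianStep : ∀ n d p →
  coeff n (eulerianStep d p) ≡
  (coeff n p + + d * coeff n (xmul1 p)) + (coeff n (xmul1 (deriv p)) - coeff n (xmul1 (xmul1 (deriv p))))
coeff-eulerianStep n d p =
  trans (coeff-add1 n (add1 p (scale1 (+ d) (xmul1 p))) (add1 (xmul1 (deriv p)) (neg1 (xmul1 (xmul1 (deriv p))))))
        (cong₂ _+_ (trans (coeff-add1 n p (scale1 (+ d) (xmul1 p)))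
                          (cong (_+_ (coeff n p)) (coeff-scale1 n (+ d) (xmul1 p))))
                   (trans (coeff-add1 n (xmul1 (deriv p)) (neg1 (xmul1 (xmul1 (deriv p)))))
                          (cong (_+_ (coeff n (xmul1 (deriv p)))) (coeff-neg1 n (xmul1 (xmul1 (deriv p)))))))

eulerianStep-cong : ∀ d {p q} → p ≋ q → eulerianStep d p ≋ eulerianStep d q
eulerianStep-cong d {p} {q} p≋q n = begin
  coeff n (eulerianStep d p)
    ≡⟨ coeff-eulerianStep n d p ⟩
  (coeff n p + + d * coeff n (xmul1 p)) + (coeff n (xmul1 p′) - coeff n (xmul1 (xmul1 p′)))
    ≡⟨ cong₂ (λ a b → (a + + d * b) + (coeff n (xmul1 p′) - coeff n (xmul1 (xmul1 p′))))
             (p≋q n) (xmul1-cong p≋q n) ⟩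
  (coeff n q + + d * coeff n (xmul1 q)) + (coeff n (xmul1 p′) - coeff n (xmul1 (xmul1 p′)))
    ≡⟨ cong₂ (λ a b → (coeff n q + + d * coeff n (xmul1 q)) + (a - b))
             (xmul1-deriv-cong {p} {q} p≋q n)
             (xmul1-cong {xmul1 p′} {xmul1 q′} (xmul1-deriv-cong {p} {q} p≋q) n) ⟩
  (coeff n q + + d * coeff n (xmul1 q)) + (coeff n (xmul1 q′) - coeff n (xmul1 (xmul1 q′)))
    ≡⟨ coeff-eulerianStep n d q ⟨
  coeff n (eulerianStep d q) ∎
  where
  p′ q′ : Poly1
  p′ = deriv p
  q′ = deriv q

oneMinusX2 : Poly2 → Poly2
oneMinusX2 P = sub2 P (xmul2 P)

-- Fstep d G unfolds definitionally to divOneMinusY (FstepNumerator d G).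
FstepNumerator : ℕ → Poly2 → Poly2
FstepNumerator d G = sub2 (sub2 G (xmul2 (ypow2 d G))) (ymul2 (oneMinusX2 (substXY G)))

evalY1-oneMinusX2-substXY : ∀ n G →
  coeff n (evalY1 (oneMinusX2 (substXY G))) ≡ coeff n (evalY1 G) - coeff n (xmul1 (evalY1 G))
evalY1-oneMinusX2-substXY n G =
  trans (evalY1-sub2 n (substXY G) (xmul2 (substXY G)))
        (cong₂ _-_ (evalY1-substXY G n)
                   (trans (evalY1-xmul2 (substXY G) n) (xmul1-cong (evalY1-substXY G) n)))

derivY1-oneMinusX2-substXY : ∀ n G →
  coeff n (derivY1 (oneMinusX2 (substXY G))) ≡
  (coeff n (xmul1 (deriv (evalY1 G))) + coeff n (derivY1 G))
    - (coeff n (xmul1 (xmul1 (deriv (evalY1 G)))) + coeff n (xmul1 (derivY1 G)))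
derivY1-oneMinusX2-substXY n G =
  trans (derivY1-sub2 n (substXY G) (xmul2 (substXY G)))
        (cong₂ _-_ (trans (derivY1-substXY G n) (coeff-add1 n (xmul1 (deriv (evalY1 G))) (derivY1 G)))
                   (trans (derivY1-xmul2 (substXY G) n)
                   (trans (xmul1-cong (derivY1-substXY G) n)
                          (coeff-xmul1-add1 n (xmul1 (deriv (evalY1 G))) (derivY1 G)))))

derivY1-xmul2-ypow2 : ∀ n k G →
  coeff n (derivY1 (xmul2 (ypow2 k G))) ≡ + k * coeff n (xmul1 (evalY1 G)) + coeff n (xmul1 (derivY1 G))
derivY1-xmul2-ypow2 n k G = begin
  coeff n (derivY1 (xmul2 (ypow2 k G)))
    ≡⟨ derivY1-xmul2 (ypow2 k G) n ⟩
  coeff n (xmul1 (derivY1 (ypow2 k G)))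
    ≡⟨ xmul1-cong (derivY1-ypow2 k G) n ⟩
  coeff n (xmul1 (add1 (scale1 (+ k) (evalY1 G)) (derivY1 G)))
    ≡⟨ coeff-xmul1-add1 n (scale1 (+ k) (evalY1 G)) (derivY1 G) ⟩
  coeff n (xmul1 (scale1 (+ k) (evalY1 G))) + coeff n (xmul1 (derivY1 G))
    ≡⟨ cong (_+ coeff n (xmul1 (derivY1 G))) (coeff-xmul1-scale1 n (+ k) (evalY1 G)) ⟩
  + k * coeff n (xmul1 (evalY1 G)) + coeff n (xmul1 (derivY1 G)) ∎

evalY1-FstepNumerator : ∀ d G → evalY1 (FstepNumerator d G) ≋ []
evalY1-FstepNumerator d G n = begin
  coeff n (evalY1 (FstepNumerator d G))
    ≡⟨ evalY1-sub2 n (sub2 G (xmul2 (ypow2 d G))) (ymul2 (oneMinusX2 (substXY G))) ⟩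
  coeff n (evalY1 (sub2 G (xmul2 (ypow2 d G)))) - coeff n (evalY1 (oneMinusX2 (substXY G)))
    ≡⟨ cong₂ _-_ (trans (evalY1-sub2 n G (xmul2 (ypow2 d G)))
                        (cong (_-_ g) (trans (evalY1-xmul2 (ypow2 d G) n)
                                             (cong (coeff n ∘ xmul1) (evalY1-ypow2 d G)))))
                 (evalY1-oneMinusX2-substXY n G) ⟩
  (g - xg) - (g - xg)
    ≡⟨ +-inverseʳ (g - xg) ⟩
  0ℤ ∎
  where
  g xg : ℤ
  g  = coeff n (evalY1 G)
  xg = coeff n (xmul1 (evalY1 G))

derivY1-FstepNumerator : ∀ d G → neg1 (derivY1 (FstepNumerator (suc d) G)) ≋ eulerianStep d (evalY1 G)
derivY1-FstepNumerator d G n = begin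
  coeff n (neg1 (derivY1 (FstepNumerator (suc d) G)))
    ≡⟨ coeff-neg1 n (derivY1 (FstepNumerator (suc d) G)) ⟩
  - coeff n (derivY1 (sub2 (sub2 G (xmul2 (ypow2 (suc d) G))) (ymul2 T)))
    ≡⟨ cong -_ (derivY1-sub2 n (sub2 G (xmul2 (ypow2 (suc d) G))) (ymul2 T)) ⟩
  - (coeff n (derivY1 (sub2 G (xmul2 (ypow2 (suc d) G)))) - coeff n (add1 (evalY1 T) (derivY1 T)))
    ≡⟨ cong₂ (λ a b → - (a - b))
             (trans (derivY1-sub2 n G (xmul2 (ypow2 (suc d) G)))
                    (cong (_-_ δ) (derivY1-xmul2-ypow2 n (suc d) G)))
             (trans (coeff-add1 n (evalY1 T) (derivY1 T))
                    (cong₂ _+_ (evalY1-oneMinusX2-substXY n G) (derivY1-oneMinusX2-substXY n G))) ⟩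
  - ((δ - (+ suc d * xg + xδ)) - ((g - xg) + ((xg′ + δ) - (xxg′ + xδ))))
    ≡⟨ cancel (+ d) g xg xg′ xxg′ δ xδ ⟩
  (g + + d * xg) + (xg′ - xxg′)
    ≡⟨ coeff-eulerianStep n d (evalY1 G) ⟨
  coeff n (eulerianStep d (evalY1 G)) ∎
  where
  T : Poly2
  T = oneMinusX2 (substXY G)
  g xg xg′ xxg′ δ xδ : ℤ
  g    = coeff n (evalY1 G)
  xg   = coeff n (xmul1 (evalY1 G))
  xg′  = coeff n (xmul1 (deriv (evalY1 G)))
  xxg′ = coeff n (xmul1 (xmul1 (deriv (evalY1 G))))
  δ    = coeff n (derivY1 G)
  xδ   = coeff n (xmul1 (derivY1 G))
  -- + suc d reduces to 1ℤ + + d, which is how the ring solver sees it.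
  cancel : ∀ d g xg xg′ xxg′ δ xδ →
    - ((δ - ((1ℤ + d) * xg + xδ)) - ((g - xg) + ((xg′ + δ) - (xxg′ + xδ)))) ≡ (g + d * xg) + (xg′ - xxg′)
  cancel = solve-∀

evalY1-Fstep : ∀ d G → evalY1 (Fstep (suc d) G) ≋ eulerianStep d (evalY1 G)
evalY1-Fstep d G n =
  trans (evalY1-divOneMinusY (FstepNumerator (suc d) G) (evalY1-FstepNumerator (suc d) G) n)
        (derivY1-FstepNumerator d G n)

evalY1-F1 : evalY1 (F 1) ≋ A 1
evalY1-F1 zero                = refl
evalY1-F1 (suc zero)          = refl
evalY1-F1 (suc (suc zero))    = refl
evalY1-F1 (suc (suc (suc n))) = refl

evalY1-F : ∀ k → evalY1 (F (suc k)) ≋ A (suc k)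
evalY1-F zero    = evalY1-F1
evalY1-F (suc k) n =
  trans (evalY1-Fstep (suc k) (F (suc k)) n)
        (eulerianStep-cong (suc k) {evalY1 (F (suc k))} {A (suc k)} (evalY1-F k) n)

lemma3p2 : (d : ℕ) → 1 ≤ d → (n : ℕ) → coeff n (evalY1 (F d)) ≡ coeff n (A d)
lemma3p2 (suc k) _ = evalY1-F k
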